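{- Let $G=(V,E)$ be a connected non-trivial graph and $t\ge 2$ an integer. Let $x\in V$ and $w=x^{j-1}z_jz_{j+1}\cdots z_t\in V^t$ with $1\le j\le t-1$ and $x\ne z_j$. Then $$d_{S(G,t)}(x^t,w)=\min_{P_i\in\mathcal{P}(x,z_j)}\left\{d_{S(G,t-j)}\left(\left(z_j^{(i)}\right)^{t-j},\,z_{j+1}\cdots z_t\right)\right\}+(2^{t-j+1}-1)\,d_G(x,z_j)-(2^{t-j}-1).$$
   Context: For a graph $G=(V,E)$ and a positive integer $t$, $V^t$ denotes the set of words of length $t$ over the alphabet $V$; concatenation of words is written by juxtaposition, and $x^k$ denotes the word consisting of $k$ copies of the letter $x$. The generalized Sierpiński graph $S(G,t)$ has vertex set $V^t$ and edge set $\{\{w u_i u_j^{d-1}, w u_j u_i^{d-1}\} : \{u_i,u_j\}\in E,\ d\in\{1,\dots,t\},\ w\in V^{t-d}\}$. $d_H$ denotes the shortest-path distance in a graph $H$. For $x,y\in V$, $\mathcal{P}(x,y)$ is the set of all shortest paths in $G$ between $x$ and $y$, and for $P_i\in\mathcal{P}(x,y)$, $y^{(i)}$ denotes the neighbour of $y$ lying on $P_i$. -}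

module Defs where

open import Data.Nat using (ℕ; zero; suc; _+_; _≤_)
open import Data.Fin using (Fin)
open import Data.Vec using (Vec; _∷_; _++_; replicate)
open import Data.Product using (Σ; ∃; _×_; _,_)
open import Relation.Binary.PropositionalEquality using (_≡_)
open import Relation.Nullary using (¬_)

record Graph : Set₁ where
  field
    n      : ℕ
    Adj    : Fin n → Fin n → Set
    sym    : ∀ {u v} → Adj u v → Adj v u
    irrefl : ∀ {u} → ¬ Adj u u

data Walk {A : Set} (R : A → A → Set) : A → A → ℕ → Set where
  here : ∀ {u} → Walk R u u 0
  step : ∀ {u v w k} → Walk R u v k → R v w → Walk R u w (suc k)

-- The vertex preceding the last vertex of a nonempty walk
-- (for a shortest path P_i from x to y this is y^{(i)}).
prev : ∀ {A : Set} {R : A → A → Set} {u w : A} {k : ℕ} → Walk R u w (suc k) → A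
prev (step {v = v} p r) = v

Dist : {A : Set} → (A → A → Set) → A → A → ℕ → Set
Dist R u v k = Walk R u v k × (∀ m → Walk R u v m → k ≤ m)

Connected : Graph → Set
Connected G = ∀ u v → ∃ λ k → Walk (Graph.Adj G) u v k

NonTrivial : Graph → Set
NonTrivial G = 2 ≤ Graph.n G

-- Adjacency of the generalized Sierpiński graph S(G,t) on V^t = Vec (Fin n) t:
-- { w a b^{d-1} , w b a^{d-1} } for {a,b} ∈ E, 1 ≤ d ≤ t, w ∈ V^{t-d}
-- (here p = t - d and d - 1 is the number of repeated letters).
data SAdj (G : Graph) : (t : ℕ) → Vec (Fin (Graph.n G)) t → Vec (Fin (Graph.n G)) t → Set where
  sedge : ∀ {p e} (w : Vec (Fin (Graph.n G)) p) (a b : Fin (Graph.n G)) →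
          Graph.Adj G a b →
          SAdj G (p + suc e) (w ++ (a ∷ replicate e b)) (w ++ (b ∷ replicate e a))

SDist : (G : Graph) (t : ℕ) → Vec (Fin (Graph.n G)) t → Vec (Fin (Graph.n G)) t → ℕ → Set
SDist G t = Dist (SAdj G t)

-- M = min over shortest paths P_i ∈ P(x,y) (with d_G(x,y) = suc D) of
--     d_{S(G,k)}((y^{(i)})^k, s)
IsMinOverShortestPaths : (G : Graph) (x y : Fin (Graph.n G)) (D k : ℕ) →
                         Vec (Fin (Graph.n G)) k → ℕ → Set
IsMinOverShortestPaths G x y D k s M =
  (Σ (Walk (Graph.Adj G) x y (suc D)) λ P → SDist G k (replicate k (prev P)) s M)
  × (∀ (P : Walk (Graph.Adj G) x y (suc D)) m →
       SDist G k (replicate k (prev P)) s m → M ≤ m)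

-- In S(G,t+1), moving x^(t+1) to c^(t+1) along a geodesic of G costs (2^(t+1) − 1) d(x,c),
-- and a path to c u either does this or moves to y^(t+1), then to y c^t for a neighbour y of c,
-- and crosses the edge y c^t — c y^t.  Taking the cheaper option, recursively in u, defines a potential Φ
-- that is realised by a walk, vanishes at x^t and changes by at most one along every edge;
-- hence it is the distance.  For w = x^(j−1) z s, leading letters x do not lower Φ, and every
-- option at the first letter z costs at least as much as some geodesic x … y z followed by a
-- shortest path from y^(t−j) to s, which is the quantity minimised in the formula.
module Submission where

open import Defs
open import Level using (0ℓ)
open import Data.Nat using (ℕ; zero; suc; _+_; _*_; _∸_; _^_; _≤_; _<_; z≤n; s≤s; _≟_; _≤?_)
open import Data.Nat.Properties
open import Data.Nat.Induction using (<-rec)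
open import Data.Nat.Tactic.RingSolver using (solve-∀)
open import Data.Fin using (Fin; zero; suc)
open import Data.Vec using (Vec; []; _∷_; _++_; replicate)
open import Data.List using (List; allFin; map; filter)
open import Data.List.Extrema.Nat using (min; argmin-all; min≤⊤; min≤xs)
open import Data.List.Membership.Propositional.Properties using (∈-allFin; ∈-map⁺; ∈-map⁻; ∈-filter⁺; ∈-filter⁻)
open import Data.List.Membership.Propositional using (_∈_)
import Data.List.Relation.Unary.All as All
open import Data.Product using (∃; _×_; _,_; proj₁; proj₂)
open import Data.Empty using (⊥-elim)
open import Effect.Monad using (RawMonad)
open import Function using (id)
open import Relation.Nullary using (yes; no)
open import Relation.Nullary.Decidable using (decidable-stable; ¬¬-excluded-middle)
open import Relation.Nullary.Negation using (¬¬-Monad)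
open import Relation.Nullary.Negation.Core using (DoubleNegation)
open import Relation.Binary.PropositionalEquality

open RawMonad (¬¬-Monad {0ℓ}) using (pure; _>>=_)

module _ {A : Set} {R : A → A → Set} where

  _++ʷ_ : ∀ {u v w m k} → Walk R u v m → Walk R v w k → Walk R u w (k + m)
  p ++ʷ here     = p
  p ++ʷ step q r = step (p ++ʷ q) r

  castʷ : ∀ {u v m k} → m ≡ k → Walk R u v m → Walk R u v k
  castʷ refl p = p

  edgeʷ : ∀ {u v} → R u v → Walk R u v 1
  edgeʷ r = step here r

  Walk-0⇒≡ : ∀ {u v} → Walk R u v 0 → u ≡ v
  Walk-0⇒≡ here = refl

  Dist-unique : ∀ {u v k l} → Dist R u v k → Dist R u v l → k ≡ l
  Dist-unique (p , p-minimal) (q , q-minimal) = ≤-antisym (p-minimal _ q) (q-minimal _ p)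

  -- Adjacency is an arbitrary relation, so the least length of a walk only exists classically.
  ¬¬-shortest : ∀ {u v K} → Walk R u v K → DoubleNegation (∃ (Dist R u v))
  ¬¬-shortest {u} {v} {K} = <-rec (λ K → Walk R u v K → DoubleNegation (∃ (Dist R u v))) step-case K
    where
    step-case : ∀ K → (∀ {m} → m < K → Walk R u v m → DoubleNegation (∃ (Dist R u v))) →
                Walk R u v K → DoubleNegation (∃ (Dist R u v))
    step-case K shorter p = ¬¬-excluded-middle {A = ∃ λ m → m < K × Walk R u v m} >>= λ where
      (yes (m , m<K , q)) → shorter m<K q
      (no ∄shorter)       → pure (K , p , λ m q → ≮⇒≥ λ m<K → ∄shorter (m , m<K , q))

mapʷ : {A B : Set} {R : A → A → Set} {S : B → B → Set} (f : A → B) →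
       (∀ {u v} → R u v → S (f u) (f v)) → ∀ {u v m} → Walk R u v m → Walk S (f u) (f v) m
mapʷ f g here       = here
mapʷ f g (step p r) = step (mapʷ f g p) (g r)

¬¬-∀-Fin : ∀ {n} {P : Fin n → Set} → (∀ i → DoubleNegation (P i)) → DoubleNegation (∀ i → P i)
¬¬-∀-Fin {zero}  h = pure λ ()
¬¬-∀-Fin {suc n} h =
  h zero >>= λ p₀ → ¬¬-∀-Fin (λ i → h (suc i)) >>= λ ps → pure λ where
    zero    → p₀
    (suc i) → ps i

¬¬-distances : (G : Graph) → Connected G → DoubleNegation (∀ u v → ∃ (Dist (Graph.Adj G) u v))
¬¬-distances G connected = ¬¬-∀-Fin λ u → ¬¬-∀-Fin λ v → ¬¬-shortest (proj₂ (connected u v))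

replicate-++ : ∀ {A : Set} (x : A) i t → replicate i x ++ replicate t x ≡ replicate (i + t) x
replicate-++ x zero    t = refl
replicate-++ x (suc i) t = cong (x ∷_) (replicate-++ x i t)

m+k≡n⇒m≤n : ∀ {m k n} → m + k ≡ n → m ≤ n
m+k≡n⇒m≤n {m} {k} refl = m≤m+n m k

mersenne : ℕ → ℕ
mersenne zero    = 0
mersenne (suc t) = suc (mersenne t + mersenne t)

2^t≡1+mersenne : ∀ t → 2 ^ t ≡ suc (mersenne t)
2^t≡1+mersenne zero    = refl
2^t≡1+mersenne (suc t) = trans (cong (2 *_) (2^t≡1+mersenne t)) (double-suc (mersenne t))
  where
  double-suc : ∀ m → 2 * suc m ≡ suc (suc (m + m))
  double-suc = solve-∀

mersenne-≤-suc : ∀ t → mersenne t ≤ mersenne (suc t)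
mersenne-≤-suc t = ≤-trans (m≤m+n (mersenne t) (mersenne t)) (n≤1+n _)

2^t∸1≡mersenne : ∀ t → 2 ^ t ∸ 1 ≡ mersenne t
2^t∸1≡mersenne t = cong (_∸ 1) (2^t≡1+mersenne t)

module Sierpinski (G : Graph) where
  open Graph G renaming (sym to Adj-sym)

  -- SAdj G with the common prefix peeled off one letter at a time.
  data Edge : (t : ℕ) → Vec (Fin n) t → Vec (Fin n) t → Set where
    across : ∀ {e c f} → Adj c f → Edge (suc e) (c ∷ replicate e f) (f ∷ replicate e c)
    within : ∀ {t u v} c → Edge t u v → Edge (suc t) (c ∷ u) (c ∷ v)

  SAdj⇒Edge : ∀ {t u v} → SAdj G t u v → Edge t u v
  SAdj⇒Edge (sedge w c f r) = prefixed w
    where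
    prefixed : ∀ {p e} (w : Vec (Fin n) p) →
               Edge (p + suc e) (w ++ (c ∷ replicate e f)) (w ++ (f ∷ replicate e c))
    prefixed []      = across r
    prefixed (x ∷ w) = within x (prefixed w)

  across-SAdj : ∀ {t c f} → Adj c f → SAdj G (suc t) (c ∷ replicate t f) (f ∷ replicate t c)
  across-SAdj r = sedge [] _ _ r

  consʷ : ∀ {t u v m} c → Walk (SAdj G t) u v m → Walk (SAdj G (suc t)) (c ∷ u) (c ∷ v) m
  consʷ c = mapʷ (c ∷_) λ where (sedge w a b r) → sedge (c ∷ w) a b r

  prefixʷ : ∀ {t u v m} x i → Walk (SAdj G t) u v m →
            Walk (SAdj G (i + t)) (replicate i x ++ u) (replicate i x ++ v) m
  prefixʷ x zero    p = p
  prefixʷ x (suc i) p = consʷ x (prefixʷ x i p)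

  replicate-edgeʷ : ∀ t {u v} → Adj u v → Walk (SAdj G t) (replicate t u) (replicate t v) (mersenne t)
  replicate-edgeʷ zero    r = here
  replicate-edgeʷ (suc t) {u} {v} r = castʷ (+-suc _ _)
    ((consʷ u (replicate-edgeʷ t r) ++ʷ edgeʷ (across-SAdj r)) ++ʷ consʷ v (replicate-edgeʷ t r))

  replicateʷ : ∀ t {u v ℓ} → Walk Adj u v ℓ → Walk (SAdj G t) (replicate t u) (replicate t v) (mersenne t * ℓ)
  replicateʷ t here                   = castʷ (sym (*-zeroʳ (mersenne t))) here
  replicateʷ t {ℓ = suc ℓ} (step p r) = castʷ (sym (*-suc (mersenne t) ℓ)) (replicateʷ t p ++ʷ replicate-edgeʷ t r)

  directʷ : ∀ t {x c u ℓ m} → Walk Adj x c ℓ → Walk (SAdj G t) (replicate t c) u m →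
            Walk (SAdj G (suc t)) (replicate (suc t) x) (c ∷ u) (mersenne (suc t) * ℓ + m)
  directʷ t {c = c} {ℓ = ℓ} {m} p q = castʷ (+-comm m (mersenne (suc t) * ℓ)) (replicateʷ (suc t) p ++ʷ consʷ c q)

  via-neighbourʷ : ∀ t {x y c u ℓ m} → Walk Adj x y ℓ → Adj y c → Walk (SAdj G t) (replicate t y) u m →
                   Walk (SAdj G (suc t)) (replicate (suc t) x) (c ∷ u)
                        (mersenne (suc t) * ℓ + (suc (mersenne t) + m))
  via-neighbourʷ t {y = y} {c} p r q = castʷ (rearrange _ _ _)
    (((replicateʷ (suc t) p ++ʷ consʷ y (replicate-edgeʷ t r)) ++ʷ edgeʷ (across-SAdj r)) ++ʷ consʷ c q)
    where
    rearrange : ∀ m a X → m + suc (a + X) ≡ X + (suc a + m)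
    rearrange = solve-∀

module Potential (G : Graph) (shortest : ∀ u v → ∃ (Dist (Graph.Adj G) u v)) where
  open Graph G renaming (sym to Adj-sym)
  open Sierpinski G

  d : Fin n → Fin n → ℕ
  d u v = proj₁ (shortest u v)

  geodesic : ∀ u v → Walk Adj u v (d u v)
  geodesic u v = proj₁ (proj₂ (shortest u v))

  d-minimal : ∀ {u v m} → Walk Adj u v m → d u v ≤ m
  d-minimal {u} {v} p = proj₂ (proj₂ (shortest u v)) _ p

  d-refl : ∀ u → d u u ≡ 0
  d-refl u = n≤0⇒n≡0 (d-minimal here)

  d≡0⇒≡ : ∀ {u v} → d u v ≡ 0 → u ≡ v
  d≡0⇒≡ {u} {v} e = Walk-0⇒≡ (castʷ e (geodesic u v))

  d-triangle : ∀ u v w → d u w ≤ d u v + d v w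
  d-triangle u v w = subst (d u w ≤_) (+-comm (d v w) (d u v)) (d-minimal (geodesic u v ++ʷ geodesic v w))

  Adj⇒d≡1 : ∀ {u v} → Adj u v → d u v ≡ 1
  Adj⇒d≡1 {u} {v} r with d u v in eq | d-minimal (edgeʷ r)
  ... | zero        | _      = ⊥-elim (irrefl (subst (Adj u) (sym (d≡0⇒≡ eq)) r))
  ... | suc zero    | _      = refl
  ... | suc (suc _) | s≤s ()

  d≡1⇒Adj : ∀ {u v} → d u v ≡ 1 → Adj u v
  d≡1⇒Adj {u} {v} e with castʷ e (geodesic u v)
  ... | step here r = r

  neighbours : Fin n → List (Fin n)
  neighbours c = filter (λ y → d y c ≟ 1) (allFin n)

  -- Φ t x (c u) is the length of the better of the two ways from x^t to c u: move x^t to c^t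
  -- and then c^t to u inside the copy c, or move x^t to y^t for a neighbour y of c, cross the
  -- edge y c^t — c y^t, and move y^t to u.  It turns out to be d_{S(G,t)}(x^t, c u).
  Φ : (t : ℕ) → Fin n → Vec (Fin n) t → ℕ
  Φ zero    x []      = 0
  Φ (suc t) x (c ∷ u) =
    min (mersenne (suc t) * d x c + Φ t c u)
        (map (λ y → mersenne (suc t) * d x y + (suc (mersenne t) + Φ t y u)) (neighbours c))

  module _ (t : ℕ) (x c : Fin n) (u : Vec (Fin n) t) where
    private
      A = mersenne (suc t)
      via-cost : Fin n → ℕ
      via-cost y = A * d x y + (suc (mersenne t) + Φ t y u)

    Φ≤direct : Φ (suc t) x (c ∷ u) ≤ A * d x c + Φ t c u
    Φ≤direct = min≤⊤ (A * d x c + Φ t c u) (map via-cost (neighbours c))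

    Φ≤via : ∀ y → d y c ≡ 1 → Φ (suc t) x (c ∷ u) ≤ A * d x y + (suc (mersenne t) + Φ t y u)
    Φ≤via y e = All.lookup (min≤xs _ (map via-cost (neighbours c)))
                           (∈-map⁺ via-cost (∈-filter⁺ (λ y → d y c ≟ 1) (∈-allFin y) e))

    Φ-elim : (P : ℕ → Set) → P (A * d x c + Φ t c u) →
             (∀ y → d y c ≡ 1 → P (A * d x y + (suc (mersenne t) + Φ t y u))) → P (Φ (suc t) x (c ∷ u))
    Φ-elim P direct via = argmin-all id direct (All.tabulate via-member)
      where
      via-member : ∀ {m} → m ∈ map via-cost (neighbours c) → P m
      via-member m∈ with ∈-map⁻ via-cost m∈
      ... | y , y∈ , refl = via y (proj₂ (∈-filter⁻ (λ y → d y c ≟ 1) {xs = allFin n} y∈))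

  Φ-replicate : ∀ t y v → Φ t y (replicate t v) ≡ mersenne t * d y v
  Φ-replicate zero    y v = refl
  Φ-replicate (suc t) y v = ≤-antisym upper lower
    where
    open ≤-Reasoning
    A = mersenne (suc t)
    a = mersenne t
    upper : Φ (suc t) y (replicate (suc t) v) ≤ A * d y v
    upper = begin
      Φ (suc t) y (v ∷ replicate t v)    ≤⟨ Φ≤direct t y v (replicate t v) ⟩
      A * d y v + Φ t v (replicate t v)  ≡⟨ cong (A * d y v +_) (Φ-replicate t v v) ⟩
      A * d y v + a * d v v              ≡⟨ cong (λ q → A * d y v + a * q) (d-refl v) ⟩
      A * d y v + a * 0                  ≡⟨ cong (A * d y v +_) (*-zeroʳ a) ⟩
      A * d y v + 0                      ≡⟨ +-identityʳ _ ⟩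
      A * d y v                          ∎
    lower : A * d y v ≤ Φ (suc t) y (replicate (suc t) v)
    lower = Φ-elim t y v (replicate t v) (A * d y v ≤_) (m≤m+n _ _) via
      where
      via : ∀ y′ → d y′ v ≡ 1 → A * d y v ≤ A * d y y′ + (suc a + Φ t y′ (replicate t v))
      via y′ e = begin
        A * d y v                                 ≤⟨ *-monoʳ-≤ A (d-triangle y y′ v) ⟩
        A * (d y y′ + d y′ v)                     ≡⟨ cong (λ q → A * (d y y′ + q)) e ⟩
        A * (d y y′ + 1)                          ≡⟨ split a (d y y′) ⟩
        A * d y y′ + (suc a + a * 1)              ≡⟨ cong (λ q → A * d y y′ + (suc a + a * q)) (sym e) ⟩
        A * d y y′ + (suc a + a * d y′ v)         ≡⟨ cong (λ q → A * d y y′ + (suc a + q)) (sym (Φ-replicate t y′ v)) ⟩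
        A * d y y′ + (suc a + Φ t y′ (replicate t v)) ∎
        where
        split : ∀ a p → suc (a + a) * (p + 1) ≡ suc (a + a) * p + (suc a + a * 1)
        split = solve-∀

  Φ-replicate-self : ∀ t x → Φ t x (replicate t x) ≡ 0
  Φ-replicate-self t x = trans (Φ-replicate t x x) (trans (cong (mersenne t *_) (d-refl x)) (*-zeroʳ (mersenne t)))

  Φ-replicate-neighbour : ∀ t {c f} → Adj c f → Φ t c (replicate t f) ≡ mersenne t
  Φ-replicate-neighbour t r = trans (Φ-replicate t _ _) (trans (cong (mersenne t *_) (Adj⇒d≡1 r)) (*-identityʳ _))

  Φ-triangle : ∀ t x y w → Φ t x w ≤ mersenne t * d x y + Φ t y w
  Φ-triangle zero    x y []      = z≤n
  Φ-triangle (suc t) x y (c ∷ u) =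
    Φ-elim t y c u (λ m → Φ (suc t) x (c ∷ u) ≤ A * d x y + m)
      (≤-trans (Φ≤direct t x c u) (scaled (d x y) (d y c) (d-triangle x y c)))
      (λ y′ e → ≤-trans (Φ≤via t x c u y′ e) (scaled (d x y) (d y y′) (d-triangle x y y′)))
    where
    A = mersenne (suc t)
    scaled : ∀ {p r} q s → p ≤ q + s → A * p + r ≤ A * q + (A * s + r)
    scaled {p} {r} q s p≤q+s = ≤-trans (+-monoˡ-≤ r (*-monoʳ-≤ A p≤q+s))
      (≤-reflexive (trans (cong (_+ r) (*-distribˡ-+ A q s)) (+-assoc (A * q) (A * s) r)))

  Φ-cons-self : ∀ t x u → Φ t x u ≤ Φ (suc t) x (x ∷ u)
  Φ-cons-self t x u = Φ-elim t x x u (Φ t x u ≤_) (m≤n+m _ _) λ y _ →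
    ≤-trans (Φ-triangle t x y u) (+-mono-≤ (*-monoˡ-≤ (d x y) (mersenne-≤-suc t)) (m≤n+m _ _))

  Φ-across : ∀ t x {c f} → Adj c f → Φ (suc t) x (f ∷ replicate t c) ≤ suc (Φ (suc t) x (c ∷ replicate t f))
  Φ-across t x {c} {f} r =
    Φ-elim t x c (replicate t f) (λ m → Φ (suc t) x (f ∷ replicate t c) ≤ suc m) direct via
    where
    open ≤-Reasoning
    A = mersenne (suc t)
    a = mersenne t

    through-c : Φ (suc t) x (f ∷ replicate t c) ≤ A * d x c + suc a
    through-c = begin
      Φ (suc t) x (f ∷ replicate t c)               ≤⟨ Φ≤via t x f (replicate t c) c (Adj⇒d≡1 r) ⟩
      A * d x c + (suc a + Φ t c (replicate t c))   ≡⟨ cong (λ q → A * d x c + (suc a + q)) (Φ-replicate-self t c) ⟩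
      A * d x c + (suc a + 0)                       ≡⟨ cong (A * d x c +_) (+-identityʳ (suc a)) ⟩
      A * d x c + suc a                             ∎

    direct : Φ (suc t) x (f ∷ replicate t c) ≤ suc (A * d x c + Φ t c (replicate t f))
    direct = begin
      Φ (suc t) x (f ∷ replicate t c)       ≤⟨ through-c ⟩
      A * d x c + suc a                     ≡⟨ +-suc (A * d x c) a ⟩
      suc (A * d x c + a)                   ≡⟨ cong (λ q → suc (A * d x c + q)) (Φ-replicate-neighbour t r) ⟨
      suc (A * d x c + Φ t c (replicate t f)) ∎

    via : ∀ y → d y c ≡ 1 →
          Φ (suc t) x (f ∷ replicate t c) ≤ suc (A * d x y + (suc a + Φ t y (replicate t f)))
    via y e with d y f in d-yf
    ... | zero with refl ← d≡0⇒≡ d-yf = begin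
      Φ (suc t) x (y ∷ replicate t c)       ≤⟨ Φ≤direct t x y (replicate t c) ⟩
      A * d x y + Φ t y (replicate t c)     ≡⟨ cong (A * d x y +_) (Φ-replicate-neighbour t (d≡1⇒Adj e)) ⟩
      A * d x y + a                         ≤⟨ m+k≡n⇒m≤n (grow (A * d x y) a) ⟩
      suc (A * d x y + (suc a + 0))         ≡⟨ cong (λ q → suc (A * d x y + (suc a + q))) (Φ-replicate-self t y) ⟨
      suc (A * d x y + (suc a + Φ t y (replicate t y))) ∎
      where
      grow : ∀ X a → X + a + 2 ≡ suc (X + (suc a + 0))
      grow = solve-∀
    ... | suc zero = begin
      Φ (suc t) x (f ∷ replicate t c)               ≤⟨ Φ≤via t x f (replicate t c) y d-yf ⟩
      A * d x y + (suc a + Φ t y (replicate t c))   ≡⟨ cong (λ q → A * d x y + (suc a + q)) (Φ-replicate-neighbour t (d≡1⇒Adj e)) ⟩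
      A * d x y + (suc a + a)                       ≡⟨ cong (λ q → A * d x y + (suc a + q)) (Φ-replicate-neighbour t (d≡1⇒Adj d-yf)) ⟨
      A * d x y + (suc a + Φ t y (replicate t f))   ≤⟨ n≤1+n _ ⟩
      suc (A * d x y + (suc a + Φ t y (replicate t f))) ∎
    ... | suc (suc k) = begin
      Φ (suc t) x (f ∷ replicate t c)               ≤⟨ through-c ⟩
      A * d x c + suc a                             ≤⟨ +-monoˡ-≤ (suc a) (*-monoʳ-≤ A (d-triangle x y c)) ⟩
      A * (d x y + d y c) + suc a                   ≡⟨ cong (λ q → A * (d x y + q) + suc a) e ⟩
      A * (d x y + 1) + suc a                       ≤⟨ m+k≡n⇒m≤n (grow (d x y) a k) ⟩
      suc (A * d x y + (suc a + a * suc (suc k)))   ≡⟨ cong (λ q → suc (A * d x y + (suc a + a * q))) d-yf ⟨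
      suc (A * d x y + (suc a + a * d y f))         ≡⟨ cong (λ q → suc (A * d x y + (suc a + q))) (Φ-replicate t y f) ⟨
      suc (A * d x y + (suc a + Φ t y (replicate t f))) ∎
      where
      grow : ∀ X a k → suc (a + a) * (X + 1) + suc a + a * k ≡ suc (suc (a + a) * X + (suc a + a * suc (suc k)))
      grow = solve-∀

  Φ-step : ∀ t x {u v} → Edge t u v → Φ t x v ≤ suc (Φ t x u)
  Φ-step (suc t) x (across r) = Φ-across t x r
  Φ-step (suc t) x {c ∷ u} {c ∷ v} (within c uv) =
    Φ-elim t x c u (λ m → Φ (suc t) x (c ∷ v) ≤ suc m)
      (≤-trans (Φ≤direct t x c v) (shift (mersenne (suc t) * d x c) (Φ-step t c uv)))
      (λ y e → ≤-trans (Φ≤via t x c v y e) (shift (mersenne (suc t) * d x y) (shift (suc (mersenne t)) (Φ-step t y uv))))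
    where
    shift : ∀ K {p q} → p ≤ suc q → K + p ≤ suc (K + q)
    shift K {q = q} p≤1+q = ≤-trans (+-monoʳ-≤ K p≤1+q) (≤-reflexive (+-suc K q))

  Φ≤length : ∀ {t x w m} → Walk (SAdj G t) (replicate t x) w m → Φ t x w ≤ m
  Φ≤length {t} {x} {w} {m} p = subst (λ q → Φ t x w ≤ q + m) (Φ-replicate-self t x) (increment p)
    where
    increment : ∀ {u v m} → Walk (SAdj G t) u v m → Φ t x v ≤ Φ t x u + m
    increment here       = m≤m+n _ 0
    increment (step p r) = ≤-trans (Φ-step t x (SAdj⇒Edge r))
                                   (≤-trans (s≤s (increment p)) (≤-reflexive (sym (+-suc _ _))))

  Φ-walk : ∀ t x w → Walk (SAdj G t) (replicate t x) w (Φ t x w)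
  Φ-walk zero    x []      = here
  Φ-walk (suc t) x (c ∷ u) =
    Φ-elim t x c u (Walk (SAdj G (suc t)) (replicate (suc t) x) (c ∷ u))
      (directʷ t (geodesic x c) (Φ-walk t c u))
      (λ y e → via-neighbourʷ t (geodesic x y) (d≡1⇒Adj e) (Φ-walk t y u))

  Φ-dist : ∀ t x w → SDist G t (replicate t x) w (Φ t x w)
  Φ-dist t x w = Φ-walk t x w , λ _ → Φ≤length

  Φ-prefix : ∀ i {t} x w → Φ t x w ≤ Φ (i + t) x (replicate i x ++ w)
  Φ-prefix zero    x w = ≤-refl
  Φ-prefix (suc i) x w = ≤-trans (Φ-prefix i x w) (Φ-cons-self _ x (replicate i x ++ w))

  first-letter-bound : ∀ {k x z s D′ M} → d x z ≡ suc D′ → IsMinOverShortestPaths G x z D′ k s M →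
                       mersenne (suc k) * D′ + (suc (mersenne k) + M) ≤ Φ (suc k) x (z ∷ s)
  first-letter-bound {k} {x} {z} {s} {D′} {M} d-xz ((step {v = y₀} _ r₀ , _ , M-least) , M-least-on-geodesics) =
    Φ-elim k x z s (A * D′ + (suc a + M) ≤_) direct via
    where
    open ≤-Reasoning
    A = mersenne (suc k)
    a = mersenne k

    direct : A * D′ + (suc a + M) ≤ A * d x z + Φ k z s
    direct = begin
      A * D′ + (suc a + M)              ≤⟨ +-monoʳ-≤ (A * D′) (+-monoʳ-≤ (suc a) M≤) ⟩
      A * D′ + (suc a + (Φ k z s + a))  ≡⟨ regroup a D′ (Φ k z s) ⟩
      A * suc D′ + Φ k z s              ≡⟨ cong (λ q → A * q + Φ k z s) d-xz ⟨
      A * d x z + Φ k z s               ∎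
      where
      M≤ = M-least _ (replicate-edgeʷ k r₀ ++ʷ Φ-walk k z s)
      regroup : ∀ a D F → suc (a + a) * D + (suc a + (F + a)) ≡ suc (a + a) * suc D + F
      regroup = solve-∀

    via : ∀ y → d y z ≡ 1 → A * D′ + (suc a + M) ≤ A * d x y + (suc a + Φ k y s)
    via y e with d x y ≟ D′
    ... | yes d-xy = begin
      A * D′ + (suc a + M)          ≤⟨ +-monoʳ-≤ (A * D′) (+-monoʳ-≤ (suc a) M≤) ⟩
      A * D′ + (suc a + Φ k y s)    ≡⟨ cong (λ q → A * q + (suc a + Φ k y s)) d-xy ⟨
      A * d x y + (suc a + Φ k y s) ∎
      where
      M≤ = M-least-on-geodesics (step (castʷ d-xy (geodesic x y)) (d≡1⇒Adj e)) _ (Φ-dist k y s)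
    ... | no d-xy≢D′ = begin
      A * D′ + (suc a + M)                     ≤⟨ +-monoʳ-≤ (A * D′) (+-monoʳ-≤ (suc a) M≤) ⟩
      A * D′ + (suc a + (Φ k y s + (a + a)))   ≤⟨ m+k≡n⇒m≤n (regroup a D′ (Φ k y s)) ⟩
      A * suc D′ + (suc a + Φ k y s)           ≤⟨ +-monoˡ-≤ _ (*-monoʳ-≤ A D′<d-xy) ⟩
      A * d x y + (suc a + Φ k y s)            ∎
      where
      M≤ = M-least _ ((replicate-edgeʷ k r₀ ++ʷ replicate-edgeʷ k (Adj-sym (d≡1⇒Adj e))) ++ʷ Φ-walk k y s)
      D′≤d-xy : D′ ≤ d x y
      D′≤d-xy = ≤-pred (subst₂ _≤_ d-xz (trans (cong (d x y +_) e) (+-comm (d x y) 1)) (d-triangle x y z))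
      D′<d-xy : D′ < d x y
      D′<d-xy = ≤∧≢⇒< D′≤d-xy (λ D′≡d-xy → d-xy≢D′ (sym D′≡d-xy))
      regroup : ∀ a D F → suc (a + a) * D + (suc a + (F + (a + a))) + 1 ≡ suc (a + a) * suc D + (suc a + F)
      regroup = solve-∀

  lower-bound : ∀ i {k x z s D′ M m} → d x z ≡ suc D′ → IsMinOverShortestPaths G x z D′ k s M →
                Walk (SAdj G (i + suc k)) (replicate (i + suc k) x) (replicate i x ++ (z ∷ s)) m →
                mersenne (suc k) * D′ + (suc (mersenne k) + M) ≤ m
  lower-bound i d-xz M-least p =
    ≤-trans (first-letter-bound d-xz M-least) (≤-trans (Φ-prefix i _ _) (Φ≤length p))

target≡ : ∀ M k D′ → M + (2 ^ suc k ∸ 1) * suc D′ ∸ (2 ^ k ∸ 1) ≡ mersenne (suc k) * D′ + (suc (mersenne k) + M)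
target≡ M k D′ rewrite 2^t∸1≡mersenne (suc k) | 2^t∸1≡mersenne k =
  trans (cong (_∸ mersenne k) (regroup M (mersenne k) D′)) (m+n∸n≡m _ (mersenne k))
  where
  regroup : ∀ M a D → M + suc (a + a) * suc D ≡ suc (a + a) * D + (suc a + M) + a
  regroup = solve-∀

theorem5 : (G : Graph) → Connected G → NonTrivial G →
    (i k : ℕ) → 1 ≤ k →
    (x z : Fin (Graph.n G)) → (s : Vec (Fin (Graph.n G)) k) → x ≢ z →
    (D M : ℕ) → Dist (Graph.Adj G) x z D →
    IsMinOverShortestPaths G x z (D ∸ 1) k s M →
    SDist G (i + suc k) (replicate (i + suc k) x) (replicate i x ++ (z ∷ s))
      (M + ((2 ^ suc k) ∸ 1) * D ∸ ((2 ^ k) ∸ 1))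
theorem5 G _ _ i k _ x z s x≢z zero    M d-xz _ = ⊥-elim (x≢z (Walk-0⇒≡ (proj₁ d-xz)))
theorem5 G connected _ i k _ x z s _ (suc D′) M d-xz M-least@((step p₀ r₀ , q₀ , _) , _) =
  subst (SDist G (i + suc k) (replicate (i + suc k) x) (replicate i x ++ (z ∷ s)))
        (sym (target≡ M k D′)) (upper , lower)
  where
  open Sierpinski G
  upper : Walk (SAdj G (i + suc k)) (replicate (i + suc k) x) (replicate i x ++ (z ∷ s))
               (mersenne (suc k) * D′ + (suc (mersenne k) + M))
  upper = subst (λ w → Walk (SAdj G (i + suc k)) w (replicate i x ++ (z ∷ s)) _) (replicate-++ x i (suc k))
                (prefixʷ x i (via-neighbourʷ k p₀ r₀ q₀))
  lower : ∀ m → Walk (SAdj G (i + suc k)) (replicate (i + suc k) x) (replicate i x ++ (z ∷ s)) m →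
          mersenne (suc k) * D′ + (suc (mersenne k) + M) ≤ m
  -- The distances of G exist only under ¬¬, which suffices as ≤ is decidable.
  lower m p = decidable-stable (_ ≤? m) (¬¬-distances G connected >>= λ shortest →
    pure (Potential.lower-bound G shortest i (Dist-unique (proj₂ (shortest x z)) d-xz) M-least p))
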